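{- Let $(T,p)$ be a minimally properly stressed generic cable-strut framework in $\mathbb{R}^d$ with $T=(V,C\cup S)$, and let $(C_1,\dots,C_t)$ be a properly stressed circuit decomposition of $(T,p)$. Then for every $1\le j\le t$ the subframework of $(T,p)$ on $D_j=\bigcup_{i=1}^jC_i$ is minimally properly stressed.
   Context: $T=(V,C\cup S)$ is a simple graph whose edges (members) are cables $C$ and struts $S$; $(T,p)$ has $p:V\to\mathbb{R}^d$ with $p(u)\ne p(v)$ for members $uv$. Rigidity matrix: one row per member $uv$ with $p(u)-p(v)$ in the columns of $u$ and $p(v)-p(u)$ in those of $v$; $(T,p)$ is generic if for every nonempty set of members the rank of its rows is maximal over all realizations; $\mathcal{R}_d(\overline T)$ is the matroid on $C\cup S$ where a set is independent iff its rows are linearly independent for generic $p$. A stress is $\omega$: members $\to\mathbb{R}$ with $\sum_{e=uv\ni u}\omega(e)(p(u)-p(v))=0$ for all $u$, $\omega\le0$ on cables, $\omega\ge0$ on struts; proper if strictly negative on cables and strictly positive on struts. A framework is minimally properly stressed if it has a proper stress but deleting any single member leaves a framework with no proper stress. For circuits $C_1,\dots,C_t$ of $\mathcal{R}_d(\overline T)$ with $D_0=\emptyset$, $D_j=\bigcup_{i\le j}C_i$: $(C_1,\dots,C_t)$ is a circuit decomposition if $D_t=C\cup S$ and for all $2\le i\le t$, $C_i-D_{i-1}\ne\emptyset$ and no circuit $C'$ has $\emptyset\ne C'-D_{i-1}\subsetneq C_i-D_{i-1}$. It is a properly stressed circuit decomposition if moreover the subframework on $D_j$ has a proper stress for every $j$.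 -}

module Defs where

open import Level using (0ℓ)
open import Data.Nat using (ℕ; zero; suc) renaming (_≤_ to _≤ℕ_)
open import Data.Fin using (Fin; zero; suc; toℕ; _≟_)
open import Data.Fin.Subset using (Subset; _∈_; _∉_; _⊆_; _⊂_; _─_; _-_; ⋃; ⊤; ∣_∣; Nonempty)
open import Data.Bool using (Bool; true; false; if_then_else_)
open import Data.Vec using (lookup)
open import Data.List using (List; length; take)
import Data.List as List
open import Data.Product using (Σ; ∃; _×_; _,_)
open import Data.Sum using (_⊎_)
open import Data.Empty using (⊥)
open import Relation.Nullary using (¬_; does)
open import Relation.Binary.PropositionalEquality using (_≡_; _≢_)
open import Algebra.Structures using (IsCommutativeRing)

-- The real numbers, axiomatised as a Dedekind-complete ordered field
-- (any two such structures are isomorphic, so this pins down ℝ).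

record RealField : Set₁ where
  infixl 6 _+_
  infixl 7 _*_
  infix 4 _<_
  field
    ℝ     : Set
    _+_   : ℝ → ℝ → ℝ
    _*_   : ℝ → ℝ → ℝ
    -_    : ℝ → ℝ
    0ℝ    : ℝ
    1ℝ    : ℝ
    _⁻¹   : ℝ → ℝ
    _<_   : ℝ → ℝ → Set
    isCommutativeRing : IsCommutativeRing _≡_ _+_ _*_ -_ 0ℝ 1ℝ
    0≢1      : 0ℝ ≢ 1ℝ
    ⁻¹-inverse : ∀ x → x ≢ 0ℝ → x * (x ⁻¹) ≡ 1ℝ
    <-irrefl : ∀ x → ¬ (x < x)
    <-trans  : ∀ {x y z} → x < y → y < z → x < z
    <-trichotomy : ∀ x y → (x < y) ⊎ ((x ≡ y) ⊎ (y < x))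
    +-mono-< : ∀ {x y} z → x < y → x + z < y + z
    *-pos    : ∀ {x y} → 0ℝ < x → 0ℝ < y → 0ℝ < x * y
    lub : (P : ℝ → Set) → (∃ λ x → P x) → (∃ λ b → ∀ x → P x → (x < b ⊎ x ≡ b)) →
          ∃ λ s → (∀ x → P x → (x < s ⊎ x ≡ s)) ×
                  (∀ b → (∀ x → P x → (x < b ⊎ x ≡ b)) → (s < b ⊎ s ≡ b))

  infix 4 _≤_
  _≤_ : ℝ → ℝ → Set
  x ≤ y = x < y ⊎ x ≡ y

  _−_ : ℝ → ℝ → ℝ
  x − y = x + (- y)

  sumFin : ∀ {n} → (Fin n → ℝ) → ℝ
  sumFin {zero}  f = 0ℝ
  sumFin {suc n} f = f zero + sumFin (λ i → f (suc i))

data Kind : Set where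
  cable strut : Kind

record CSGraph (n m : ℕ) : Set where
  field
    end₁ end₂ : Fin m → Fin n
    kind      : Fin m → Kind
    noLoop    : ∀ e → end₁ e ≢ end₂ e
    noParallel : ∀ e f → ((end₁ e ≡ end₁ f × end₂ e ≡ end₂ f) ⊎
                          (end₁ e ≡ end₂ f × end₂ e ≡ end₁ f)) → e ≡ f

module Framework (R : RealField) {n m : ℕ} (T : CSGraph n m) (d : ℕ) where
  open RealField R
  open CSGraph T

  Config : Set
  Config = Fin n → Fin d → ℝ

  IsRealization : Config → Set
  IsRealization p = ∀ e → ¬ (∀ k → p (end₁ e) k ≡ p (end₂ e) k)

  rigRow : Config → Fin m → Fin n → Fin d → ℝ
  rigRow p e v k =
    if does (v ≟ end₁ e) then p (end₁ e) k − p (end₂ e) k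
    else if does (v ≟ end₂ e) then p (end₂ e) k − p (end₁ e) k
    else 0ℝ

  sumOver : Subset m → (Fin m → ℝ) → ℝ
  sumOver F f = sumFin (λ e → if lookup F e then f e else 0ℝ)

  RowsIndep : Config → Subset m → Set
  RowsIndep p F = (c : Fin m → ℝ) →
    (∀ v k → sumOver F (λ e → c e * rigRow p e v k) ≡ 0ℝ) →
    ∀ e → e ∈ F → c e ≡ 0ℝ

  RankAtLeast : Config → Config → Subset m → Set
  RankAtLeast p q F = ∀ I → I ⊆ F → RowsIndep q I →
    Σ (Subset m) λ J → J ⊆ F × RowsIndep p J × ∣ J ∣ ≡ ∣ I ∣

  Generic : Config → Set
  Generic p = IsRealization p ×
    (∀ F → Nonempty F → ∀ q → IsRealization q → RankAtLeast p q F)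

  MIndep : Subset m → Set
  MIndep I = ∀ q → Generic q → RowsIndep q I

  IsCircuit : Subset m → Set
  IsCircuit X = ¬ MIndep X × (∀ e → e ∈ X → MIndep (X - e))

  IsStressOn : Config → Subset m → (Fin m → ℝ) → Set
  IsStressOn p D ω =
    (∀ u k → sumOver D (λ e → ω e * rigRow p e u k) ≡ 0ℝ) ×
    (∀ e → e ∈ D → kind e ≡ cable → ω e ≤ 0ℝ) ×
    (∀ e → e ∈ D → kind e ≡ strut → 0ℝ ≤ ω e)

  IsProperStressOn : Config → Subset m → (Fin m → ℝ) → Set
  IsProperStressOn p D ω =
    IsStressOn p D ω ×
    (∀ e → e ∈ D → kind e ≡ cable → ω e < 0ℝ) ×
    (∀ e → e ∈ D → kind e ≡ strut → 0ℝ < ω e)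

  HasProperStress : Config → Subset m → Set
  HasProperStress p D = ∃ λ ω → IsProperStressOn p D ω

  MinProperlyStressed : Config → Subset m → Set
  MinProperlyStressed p D =
    HasProperStress p D × (∀ e → e ∈ D → ¬ HasProperStress p (D - e))

  -- D_j = C_1 ∪ … ∪ C_j  (with D_0 = ∅)
  Dset : List (Subset m) → ℕ → Subset m
  Dset Cs j = ⋃ (take j Cs)

  -- Cs = (C_1,…,C_t) as a list; index i : Fin t stands for C_{i+1}
  IsCircuitDecomposition : List (Subset m) → Set
  IsCircuitDecomposition Cs =
    (∀ i → IsCircuit (List.lookup Cs i)) ×
    (Dset Cs (length Cs) ≡ ⊤) ×
    (∀ (i : Fin (length Cs)) → 1 ≤ℕ toℕ i →
       Nonempty (List.lookup Cs i ─ Dset Cs (toℕ i)) ×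
       (∀ C′ → IsCircuit C′ →
          ¬ (Nonempty (C′ ─ Dset Cs (toℕ i)) ×
             (C′ ─ Dset Cs (toℕ i)) ⊂ (List.lookup Cs i ─ Dset Cs (toℕ i)))))

  IsProperlyStressedCircuitDecomposition : Config → List (Subset m) → Set
  IsProperlyStressedCircuitDecomposition p Cs =
    IsCircuitDecomposition Cs ×
    (∀ (j : Fin (length Cs)) → HasProperStress p (Dset Cs (suc (toℕ j))))

{-# OPTIONS --safe #-}
-- Let ω and ω_D be proper stresses on X and on D ⊆ X, and suppose D - e also carried a proper
-- stress ω′ for some e ∈ D. Let σ(f) be ω(f) negated on cables, so that proper means σ > 0.
-- Then σ_D(e)·ω - σ(e)·ω_D is a stress vanishing on e with the correct signs off D, and adding a
-- large multiple of ω′ corrects the signs on D - e: this is a proper stress on X - e. Hence a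
-- properly stressed subframework of a minimally properly stressed framework is minimally properly
-- stressed; each D_j of a properly stressed circuit decomposition is properly stressed by
-- definition.
module Submission where

open import Defs
open import Level using (0ℓ)
open import Data.Nat using (ℕ; zero; suc)
open import Data.Fin using (Fin; zero; suc; toℕ; _≟_)
open import Data.Fin.Subset using (Subset; ⊤; _∈_; _∉_; _⊆_; _-_; ⁅_⁆)
open import Data.Fin.Subset.Properties using (_∈?_; ⊆⊤; x∈p∧x≢y⇒x∈p-y; p─q⊆p)
open import Data.List using (List; length)
open import Data.Vec using (_∷_; lookup; there)
open import Data.Vec.Properties using ([]=⇒lookup; lookup⇒[]=)
open import Data.Bool using (true; false; if_then_else_)
open import Data.Product using (∃; _,_; proj₁; proj₂)
open import Data.Sum using (inj₁; inj₂)
open import Data.Empty using (⊥-elim)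
open import Relation.Nullary using (yes; no; contradiction)
open import Relation.Binary.PropositionalEquality
  using (_≡_; _≢_; refl; sym; trans; cong; cong₂; subst; subst₂; module ≡-Reasoning)
open import Algebra.Bundles using (CommutativeRing)
import Algebra.Properties.Ring as RingProperties
import Algebra.Properties.Semiring.Sum as SemiringSum

x∉p-x : ∀ {n} (p : Subset n) (x : Fin n) → x ∉ p - x
x∉p-x (_ ∷ p) zero    ()
x∉p-x (_ ∷ p) (suc x) (there x∈p-x) = x∉p-x p x x∈p-x

module RealFieldProperties (R : RealField) where
  open RealField R

  commutativeRing : CommutativeRing 0ℓ 0ℓ
  commutativeRing = record { isCommutativeRing = isCommutativeRing }

  open CommutativeRing commutativeRing public
    using ( +-comm; +-assoc; +-identityˡ; +-identityʳ; -‿inverseˡ; -‿inverseʳ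
          ; *-comm; *-assoc; *-identityʳ; zeroˡ; zeroʳ; distribʳ )
  open RingProperties (CommutativeRing.ring commutativeRing) public
    using (-‿distribˡ-*; -‿distribʳ-*; -‿involutive; -‿+-comm; -0#≈0#; [y-z]x≈yx-zx)
  open SemiringSum (CommutativeRing.semiring commutativeRing) public
    using (sum; sum-cong-≗; ∑-distrib-+; *-distribˡ-sum)

  private variable
    x y z c : ℝ

  <-≤-trans : x < y → y ≤ z → x < z
  <-≤-trans x<y (inj₁ y<z) = <-trans x<y y<z
  <-≤-trans x<y (inj₂ refl) = x<y

  ≤-trans : x ≤ y → y ≤ z → x ≤ z
  ≤-trans (inj₁ x<y) y≤z = inj₁ (<-≤-trans x<y y≤z)
  ≤-trans (inj₂ refl) y≤z = y≤z

  +-monoˡ-≤ : ∀ z → x ≤ y → x + z ≤ y + z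
  +-monoˡ-≤ z (inj₁ x<y) = inj₁ (+-mono-< z x<y)
  +-monoˡ-≤ z (inj₂ refl) = inj₂ refl

  +-monoʳ-≤ : ∀ z → x ≤ y → z + x ≤ z + y
  +-monoʳ-≤ {x} {y} z x≤y = subst₂ _≤_ (+-comm x z) (+-comm y z) (+-monoˡ-≤ z x≤y)

  +-mono-≤ : ∀ {u v} → x ≤ y → u ≤ v → x + u ≤ y + v
  +-mono-≤ x≤y u≤v = ≤-trans (+-monoˡ-≤ _ x≤y) (+-monoʳ-≤ _ u≤v)

  x<y⇒0<y−x : x < y → 0ℝ < y − x
  x<y⇒0<y−x {x} {y} x<y = subst (_< y − x) (-‿inverseʳ x) (+-mono-< (- x) x<y)

  x≤y⇒0≤y−x : x ≤ y → 0ℝ ≤ y − x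
  x≤y⇒0≤y−x (inj₁ x<y) = inj₁ (x<y⇒0<y−x x<y)
  x≤y⇒0≤y−x {x} (inj₂ refl) = inj₂ (sym (-‿inverseʳ x))

  0<y−x⇒x<y : 0ℝ < y − x → x < y
  0<y−x⇒x<y {y} {x} 0<y−x = subst₂ _<_ (+-identityˡ x) y−x+x≡y (+-mono-< x 0<y−x)
    where
    y−x+x≡y : y − x + x ≡ y
    y−x+x≡y = trans (+-assoc y (- x) x) (trans (cong (y +_) (-‿inverseˡ x)) (+-identityʳ y))

  x<0⇒0<-x : x < 0ℝ → 0ℝ < - x
  x<0⇒0<-x {x} x<0 = subst₂ _<_ (-‿inverseʳ x) (+-identityˡ (- x)) (+-mono-< (- x) x<0)

  0<-x⇒x<0 : 0ℝ < - x → x < 0ℝ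
  0<-x⇒x<0 {x} 0<-x = subst₂ _<_ (+-identityˡ x) (-‿inverseˡ x) (+-mono-< x 0<-x)

  0<x⇒-x<0 : 0ℝ < x → - x < 0ℝ
  0<x⇒-x<0 {x} 0<x = subst₂ _<_ (+-identityˡ (- x)) (-‿inverseʳ x) (+-mono-< (- x) 0<x)

  0<x⇒x≢0 : 0ℝ < x → x ≢ 0ℝ
  0<x⇒x≢0 0<x refl = <-irrefl 0ℝ 0<x

  0<x+y : 0ℝ < x → 0ℝ ≤ y → 0ℝ < x + y
  0<x+y {x} {y} 0<x 0≤y = <-≤-trans 0<x (subst (_≤ x + y) (+-identityʳ x) (+-monoʳ-≤ x 0≤y))

  -- If 1 < 0 then 0 < -1, hence 0 < (-1)(-1) = 1.
  0<1 : 0ℝ < 1ℝ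
  0<1 with <-trichotomy 0ℝ 1ℝ
  ... | inj₁ 0<1 = 0<1
  ... | inj₂ (inj₁ 0≡1) = ⊥-elim (0≢1 0≡1)
  ... | inj₂ (inj₂ 1<0) = ⊥-elim (<-irrefl 0ℝ (<-trans 0<1′ 1<0))
    where
    [-1][-1]≡1 : (- 1ℝ) * (- 1ℝ) ≡ 1ℝ
    [-1][-1]≡1 = trans (sym (-‿distribʳ-* (- 1ℝ) 1ℝ))
                       (trans (cong -_ (*-identityʳ (- 1ℝ))) (-‿involutive 1ℝ))
    0<1′ : 0ℝ < 1ℝ
    0<1′ = subst (0ℝ <_) [-1][-1]≡1 (*-pos (x<0⇒0<-x 1<0) (x<0⇒0<-x 1<0))

  ⁻¹-pos : 0ℝ < x → 0ℝ < x ⁻¹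
  ⁻¹-pos {x} 0<x with <-trichotomy 0ℝ (x ⁻¹)
  ... | inj₁ 0<x⁻¹ = 0<x⁻¹
  ... | inj₂ (inj₁ 0≡x⁻¹) =
    ⊥-elim (0≢1 (trans (sym (zeroʳ x)) (trans (cong (x *_) 0≡x⁻¹) (⁻¹-inverse x (0<x⇒x≢0 0<x)))))
  ... | inj₂ (inj₂ x⁻¹<0) = ⊥-elim (<-irrefl 0ℝ (<-trans 0<-1 (0<x⇒-x<0 0<1)))
    where
    0<-1 : 0ℝ < - 1ℝ
    0<-1 = subst (0ℝ <_) (trans (sym (-‿distribʳ-* x (x ⁻¹))) (cong -_ (⁻¹-inverse x (0<x⇒x≢0 0<x))))
                 (*-pos 0<x (x<0⇒0<-x x⁻¹<0))

  *-nonneg-pos : 0ℝ ≤ x → 0ℝ < y → 0ℝ ≤ x * y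
  *-nonneg-pos (inj₁ 0<x) 0<y = inj₁ (*-pos 0<x 0<y)
  *-nonneg-pos {y = y} (inj₂ refl) 0<y = inj₂ (sym (zeroˡ y))

  *-monoˡ-≤ : 0ℝ < c → x ≤ y → x * c ≤ y * c
  *-monoˡ-≤ {c} {x} {y} 0<c (inj₁ x<y) =
    inj₁ (0<y−x⇒x<y (subst (0ℝ <_) ([y-z]x≈yx-zx c y x) (*-pos (x<y⇒0<y−x x<y) 0<c)))
  *-monoˡ-≤ 0<c (inj₂ refl) = inj₂ refl

  restrict : ∀ {m} → Subset m → (Fin m → ℝ) → Fin m → ℝ
  restrict F w f = if lookup F f then w f else 0ℝ

  module _ {m} {F : Subset m} where

    restrict-∈ : ∀ (w : Fin m → ℝ) {f} → f ∈ F → restrict F w f ≡ w f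
    restrict-∈ w f∈F rewrite []=⇒lookup f∈F = refl

    restrict-∉ : ∀ (w : Fin m → ℝ) {f} → f ∉ F → restrict F w f ≡ 0ℝ
    restrict-∉ w {f} f∉F with lookup F f in eq
    ... | true  = contradiction (lookup⇒[]= f F eq) f∉F
    ... | false = refl

    restrict-supported : ∀ {w : Fin m → ℝ} → (∀ f → f ∉ F → w f ≡ 0ℝ) → ∀ f → restrict F w f ≡ w f
    restrict-supported {w} w-supported f with f ∈? F
    ... | yes f∈F = restrict-∈ w f∈F
    ... | no  f∉F = trans (restrict-∉ w f∉F) (sym (w-supported f f∉F))

    restrict-nonneg : ∀ {w : Fin m → ℝ} → (∀ f → f ∈ F → 0ℝ ≤ w f) → ∀ f → 0ℝ ≤ restrict F w f
    restrict-nonneg {w} w≥0 f with f ∈? F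
    ... | yes f∈F = subst (0ℝ ≤_) (sym (restrict-∈ w f∈F)) (w≥0 f f∈F)
    ... | no  f∉F = inj₂ (sym (restrict-∉ w f∉F))

    restrict-* : ∀ (w r : Fin m → ℝ) f → restrict F (λ f → w f * r f) f ≡ restrict F w f * r f
    restrict-* w r f with lookup F f
    ... | true  = refl
    ... | false = sym (zeroˡ (r f))

  sumFin≡sum : ∀ {n} (w : Fin n → ℝ) → sumFin w ≡ sum w
  sumFin≡sum {zero}  w = refl
  sumFin≡sum {suc n} w = cong (w zero +_) (sumFin≡sum (λ i → w (suc i)))

  sum-nonneg : ∀ {n} (w : Fin n → ℝ) → (∀ i → 0ℝ ≤ w i) → 0ℝ ≤ sum w
  sum-nonneg {zero}  w w≥0 = inj₂ refl
  sum-nonneg {suc n} w w≥0 =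
    subst (_≤ sum w) (+-identityˡ 0ℝ) (+-mono-≤ (w≥0 zero) (sum-nonneg _ (λ i → w≥0 (suc i))))

  ≤-sum : ∀ {n} (w : Fin n → ℝ) → (∀ i → 0ℝ ≤ w i) → ∀ i → w i ≤ sum w
  ≤-sum {suc n} w w≥0 zero =
    subst (_≤ sum w) (+-identityʳ (w zero)) (+-monoʳ-≤ (w zero) (sum-nonneg _ (λ i → w≥0 (suc i))))
  ≤-sum {suc n} w w≥0 (suc i) =
    ≤-trans (≤-sum _ (λ j → w≥0 (suc j)) i)
            (subst (_≤ sum w) (+-identityˡ _) (+-monoˡ-≤ _ (w≥0 zero)))

  dominated-by-multiple : ∀ {m} (F : Subset m) (g h : Fin m → ℝ) →
    (∀ f → f ∈ F → 0ℝ ≤ g f) → (∀ f → f ∈ F → 0ℝ < h f) →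
    ∃ λ s → ∀ f → f ∈ F → g f ≤ s * h f
  dominated-by-multiple {m} F g h g≥0 h>0 = s , g≤s*h
    where
    quotient : Fin m → ℝ
    quotient f = g f * h f ⁻¹

    s : ℝ
    s = sum (restrict F quotient)

    quotient≤s : ∀ f → f ∈ F → quotient f ≤ s
    quotient≤s f f∈F = subst (_≤ s) (restrict-∈ quotient f∈F) (≤-sum _ quotient-restrict≥0 f)
      where
      quotient-restrict≥0 : ∀ f → 0ℝ ≤ restrict F quotient f
      quotient-restrict≥0 = restrict-nonneg (λ f f∈F → *-nonneg-pos (g≥0 f f∈F) (⁻¹-pos (h>0 f f∈F)))

    quotient*h≡g : ∀ f → f ∈ F → quotient f * h f ≡ g f
    quotient*h≡g f f∈F = begin
      g f * h f ⁻¹ * h f    ≡⟨ *-assoc (g f) (h f ⁻¹) (h f) ⟩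
      g f * (h f ⁻¹ * h f)  ≡⟨ cong (g f *_) (*-comm (h f ⁻¹) (h f)) ⟩
      g f * (h f * h f ⁻¹)  ≡⟨ cong (g f *_) (⁻¹-inverse (h f) (0<x⇒x≢0 (h>0 f f∈F))) ⟩
      g f * 1ℝ              ≡⟨ *-identityʳ (g f) ⟩
      g f                   ∎
      where open ≡-Reasoning

    g≤s*h : ∀ f → f ∈ F → g f ≤ s * h f
    g≤s*h f f∈F = subst (_≤ s * h f) (quotient*h≡g f f∈F) (*-monoˡ-≤ (h>0 f f∈F) (quotient≤s f f∈F))

module FrameworkProperties (R : RealField) {n m : ℕ} (T : CSGraph n m) (d : ℕ) where
  open RealField R
  open RealFieldProperties R
  open CSGraph T
  open Framework R T d

  signed : Kind → ℝ → ℝ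
  signed cable x = - x
  signed strut x = x

  signed-+ : ∀ k x y → signed k (x + y) ≡ signed k x + signed k y
  signed-+ cable x y = sym (-‿+-comm x y)
  signed-+ strut x y = refl

  signed-* : ∀ k c x → signed k (c * x) ≡ c * signed k x
  signed-* cable c x = -‿distribʳ-* c x
  signed-* strut c x = refl

  signed-0 : ∀ k → signed k 0ℝ ≡ 0ℝ
  signed-0 cable = -0#≈0#
  signed-0 strut = refl

  signed-swap : ∀ k x y → signed k x * y ≡ signed k y * x
  signed-swap cable x y = begin
    - x * y    ≡⟨ sym (-‿distribˡ-* x y) ⟩
    - (x * y)  ≡⟨ cong -_ (*-comm x y) ⟩
    - (y * x)  ≡⟨ -‿distribˡ-* y x ⟩
    - y * x    ∎
    where open ≡-Reasoning
  signed-swap strut x y = *-comm x y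

  Equilibrium : Config → (Fin m → ℝ) → Set
  Equilibrium p w = ∀ u k → sum (λ f → w f * rigRow p f u k) ≡ 0ℝ

  StressEquations : Config → Subset m → (Fin m → ℝ) → Set
  StressEquations p F w = ∀ u k → sumOver F (λ f → w f * rigRow p f u k) ≡ 0ℝ

  module _ (p : Config) where

    sumOver≡sum-restrict : ∀ F (w r : Fin m → ℝ) →
      sumOver F (λ f → w f * r f) ≡ sum (λ f → restrict F w f * r f)
    sumOver≡sum-restrict F w r =
      trans (sumFin≡sum (restrict F (λ f → w f * r f))) (sum-cong-≗ (restrict-* {F = F} w r))

    stressEquations⇒equilibrium : ∀ {F w} → StressEquations p F w → Equilibrium p (restrict F w)
    stressEquations⇒equilibrium {F} {w} eqs u k =
      trans (sym (sumOver≡sum-restrict F w (λ f → rigRow p f u k))) (eqs u k)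

    equilibrium⇒stressEquations : ∀ {F w} → Equilibrium p w → (∀ f → f ∉ F → w f ≡ 0ℝ) →
      StressEquations p F w
    equilibrium⇒stressEquations {F} {w} w-eq w-supported u k =
      trans (sumOver≡sum-restrict F w r)
            (trans (sum-cong-≗ (λ f → cong (_* r f) (restrict-supported w-supported f))) (w-eq u k))
      where
      r : Fin m → ℝ
      r f = rigRow p f u k

    equilibrium-+ : ∀ {v w} → Equilibrium p v → Equilibrium p w → Equilibrium p (λ f → v f + w f)
    equilibrium-+ {v} {w} v-eq w-eq u k = begin
      sum (λ f → (v f + w f) * r f)        ≡⟨ sum-cong-≗ (λ f → distribʳ (r f) (v f) (w f)) ⟩
      sum (λ f → v f * r f + w f * r f)    ≡⟨ ∑-distrib-+ (λ f → v f * r f) (λ f → w f * r f) ⟩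
      sum (λ f → v f * r f) + sum (λ f → w f * r f) ≡⟨ cong₂ _+_ (v-eq u k) (w-eq u k) ⟩
      0ℝ + 0ℝ                              ≡⟨ +-identityʳ 0ℝ ⟩
      0ℝ                                   ∎
      where
      open ≡-Reasoning
      r : Fin m → ℝ
      r f = rigRow p f u k

    equilibrium-* : ∀ c {w} → Equilibrium p w → Equilibrium p (λ f → c * w f)
    equilibrium-* c {w} w-eq u k = begin
      sum (λ f → c * w f * r f)    ≡⟨ sum-cong-≗ (λ f → *-assoc c (w f) (r f)) ⟩
      sum (λ f → c * (w f * r f))  ≡⟨ sym (*-distribˡ-sum c (λ f → w f * r f)) ⟩
      c * sum (λ f → w f * r f)    ≡⟨ cong (c *_) (w-eq u k) ⟩
      c * 0ℝ                       ≡⟨ zeroʳ c ⟩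
      0ℝ                           ∎
      where
      open ≡-Reasoning
      r : Fin m → ℝ
      r f = rigRow p f u k

    properStress⇒signed-pos : ∀ {F w} → IsProperStressOn p F w →
      ∀ f → f ∈ F → 0ℝ < signed (kind f) (w f)
    properStress⇒signed-pos (_ , cable<0 , strut>0) f f∈F with kind f in kind-f
    ... | cable = x<0⇒0<-x (cable<0 f f∈F kind-f)
    ... | strut = strut>0 f f∈F kind-f

    signed-pos⇒properStress : ∀ {F w} → StressEquations p F w →
      (∀ f → f ∈ F → 0ℝ < signed (kind f) (w f)) → IsProperStressOn p F w
    signed-pos⇒properStress {F} {w} eqs signed>0 =
      (eqs , (λ f f∈F kf → inj₁ (cable<0 f f∈F kf)) , (λ f f∈F kf → inj₁ (strut>0 f f∈F kf))) ,
      cable<0 , strut>0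
      where
      cable<0 : ∀ f → f ∈ F → kind f ≡ cable → w f < 0ℝ
      cable<0 f f∈F kf = 0<-x⇒x<0 (subst (λ k → 0ℝ < signed k (w f)) kf (signed>0 f f∈F))
      strut>0 : ∀ f → f ∈ F → kind f ≡ strut → 0ℝ < w f
      strut>0 f f∈F kf = subst (λ k → 0ℝ < signed k (w f)) kf (signed>0 f f∈F)

    module Elimination
      {X D : Subset m} {e : Fin m} (D⊆X : D ⊆ X) (e∈D : e ∈ D)
      {ω ωD ω′ : Fin m → ℝ} (ω-proper : IsProperStressOn p X ω)
      (ωD-proper : IsProperStressOn p D ωD) (ω′-proper : IsProperStressOn p (D - e) ω′)
      where

      a b : ℝ
      a = signed (kind e) (ωD e)
      b = signed (kind e) (ω e)

      s-dominates : ∃ λ s → ∀ f → f ∈ D - e →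
        b * signed (kind f) (ωD f) ≤ s * signed (kind f) (ω′ f)
      s-dominates = dominated-by-multiple (D - e) _ _
        (λ f f∈D-e → inj₁ (*-pos (properStress⇒signed-pos ω-proper e (D⊆X e∈D))
                                 (properStress⇒signed-pos ωD-proper f (p─q⊆p D ⁅ e ⁆ f∈D-e))))
        (properStress⇒signed-pos ω′-proper)

      s : ℝ
      s = proj₁ s-dominates

      -- The first and last terms cancel on e (signed-swap); the middle one repairs the signs on D - e.
      combination : Fin m → ℝ
      combination f = a * restrict X ω f + (s * restrict (D - e) ω′ f + (- b) * restrict D ωD f)

      combination-equilibrium : Equilibrium p combination
      combination-equilibrium =
        equilibrium-+ (equilibrium-* a (restricted ω-proper))
          (equilibrium-+ (equilibrium-* s (restricted ω′-proper))
                         (equilibrium-* (- b) (restricted ωD-proper)))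
        where
        restricted : ∀ {F w} → IsProperStressOn p F w → Equilibrium p (restrict F w)
        restricted {F} ((eqs , _) , _) = stressEquations⇒equilibrium {F} eqs

      combination-e : combination e ≡ 0ℝ
      combination-e = begin
        a * restrict X ω e + (s * restrict (D - e) ω′ e + (- b) * restrict D ωD e)
          ≡⟨ cong₂ (λ x y → a * x + (s * y + (- b) * restrict D ωD e))
                   (restrict-∈ ω (D⊆X e∈D)) (restrict-∉ ω′ (x∉p-x D e)) ⟩
        a * ω e + (s * 0ℝ + (- b) * restrict D ωD e)
          ≡⟨ cong₂ (λ x y → x + (y + (- b) * restrict D ωD e)) (signed-swap (kind e) (ωD e) (ω e)) (zeroʳ s) ⟩
        b * ωD e + (0ℝ + (- b) * restrict D ωD e)
          ≡⟨ cong (λ x → b * ωD e + (0ℝ + (- b) * x)) (restrict-∈ ωD e∈D) ⟩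
        b * ωD e + (0ℝ + (- b) * ωD e)
          ≡⟨ cong (b * ωD e +_) (+-identityˡ _) ⟩
        b * ωD e + (- b) * ωD e
          ≡⟨ sym (distribʳ (ωD e) b (- b)) ⟩
        (b + - b) * ωD e
          ≡⟨ cong (_* ωD e) (-‿inverseʳ b) ⟩
        0ℝ * ωD e
          ≡⟨ zeroˡ (ωD e) ⟩
        0ℝ ∎
        where open ≡-Reasoning

      combination-off-X : ∀ f → f ∉ X → combination f ≡ 0ℝ
      combination-off-X f f∉X = begin
        a * restrict X ω f + (s * restrict (D - e) ω′ f + (- b) * restrict D ωD f)
          ≡⟨ cong₂ (λ x y → a * x + y) (restrict-∉ ω f∉X)
                   (cong₂ (λ x y → s * x + (- b) * y) (restrict-∉ ω′ f∉D-e) (restrict-∉ ωD f∉D)) ⟩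
        a * 0ℝ + (s * 0ℝ + (- b) * 0ℝ)
          ≡⟨ cong₂ _+_ (zeroʳ a) (cong₂ _+_ (zeroʳ s) (zeroʳ (- b))) ⟩
        0ℝ + (0ℝ + 0ℝ)
          ≡⟨ trans (+-identityˡ _) (+-identityˡ 0ℝ) ⟩
        0ℝ ∎
        where
        open ≡-Reasoning
        f∉D : f ∉ D
        f∉D f∈D = f∉X (D⊆X f∈D)
        f∉D-e : f ∉ D - e
        f∉D-e f∈D-e = f∉D (p─q⊆p D ⁅ e ⁆ f∈D-e)

      combination-supported : ∀ f → f ∉ X - e → combination f ≡ 0ℝ
      combination-supported f f∉X-e with f ≟ e
      ... | yes refl = combination-e
      ... | no  f≢e  = combination-off-X f (λ f∈X → f∉X-e (x∈p∧x≢y⇒x∈p-y f∈X f≢e))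

      correction≤ : ∀ f → f ≢ e →
        b * signed (kind f) (restrict D ωD f) ≤ s * signed (kind f) (restrict (D - e) ω′ f)
      correction≤ f f≢e with f ∈? D
      ... | yes f∈D
        rewrite restrict-∈ ωD f∈D | restrict-∈ ω′ (x∈p∧x≢y⇒x∈p-y f∈D f≢e)
        = proj₂ s-dominates f (x∈p∧x≢y⇒x∈p-y f∈D f≢e)
      ... | no f∉D
        rewrite restrict-∉ ωD f∉D | restrict-∉ ω′ (λ f∈D-e → f∉D (p─q⊆p D ⁅ e ⁆ f∈D-e)) | signed-0 (kind f)
        = inj₂ (trans (zeroʳ b) (sym (zeroʳ s)))

      signed-combination : ∀ f → let k = kind f in
        signed k (combination f) ≡
        a * signed k (restrict X ω f)
          + ((s * signed k (restrict (D - e) ω′ f)) − (b * signed k (restrict D ωD f)))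
      signed-combination f = begin
        signed k (a * x + (s * y + (- b) * z))
          ≡⟨ signed-+ k (a * x) _ ⟩
        signed k (a * x) + signed k (s * y + (- b) * z)
          ≡⟨ cong (signed k (a * x) +_) (signed-+ k (s * y) ((- b) * z)) ⟩
        signed k (a * x) + (signed k (s * y) + signed k ((- b) * z))
          ≡⟨ cong₂ (λ u v → u + (v + signed k ((- b) * z))) (signed-* k a x) (signed-* k s y) ⟩
        a * signed k x + (s * signed k y + signed k ((- b) * z))
          ≡⟨ cong (λ u → a * signed k x + (s * signed k y + u))
                  (trans (signed-* k (- b) z) (sym (-‿distribˡ-* b (signed k z)))) ⟩
        a * signed k x + ((s * signed k y) − (b * signed k z)) ∎
        where
        open ≡-Reasoning
        k = kind f
        x = restrict X ω f
        y = restrict (D - e) ω′ f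
        z = restrict D ωD f

      combination-signed-pos : ∀ f → f ∈ X - e → 0ℝ < signed (kind f) (combination f)
      combination-signed-pos f f∈X-e =
        subst (0ℝ <_) (sym (signed-combination f)) (0<x+y ω-term>0 (x≤y⇒0≤y−x (correction≤ f f≢e)))
        where
        f∈X : f ∈ X
        f∈X = p─q⊆p X ⁅ e ⁆ f∈X-e
        f≢e : f ≢ e
        f≢e refl = x∉p-x X e f∈X-e
        ω-term>0 : 0ℝ < a * signed (kind f) (restrict X ω f)
        ω-term>0 = subst (λ x → 0ℝ < a * signed (kind f) x) (sym (restrict-∈ ω f∈X))
          (*-pos (properStress⇒signed-pos ωD-proper e e∈D) (properStress⇒signed-pos ω-proper f f∈X))

      combination-proper : IsProperStressOn p (X - e) combination
      combination-proper = signed-pos⇒properStress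
        (equilibrium⇒stressEquations {X - e} combination-equilibrium combination-supported)
        combination-signed-pos

    properStress-elimination : ∀ {X D e} → D ⊆ X → e ∈ D →
      HasProperStress p X → HasProperStress p D → HasProperStress p (D - e) → HasProperStress p (X - e)
    properStress-elimination D⊆X e∈D (_ , ω-proper) (_ , ωD-proper) (_ , ω′-proper) =
      _ , Elimination.combination-proper D⊆X e∈D ω-proper ωD-proper ω′-proper

    minProperlyStressed-⊆ : ∀ {X D} → D ⊆ X → MinProperlyStressed p X → HasProperStress p D →
      MinProperlyStressed p D
    minProperlyStressed-⊆ D⊆X (X-stressed , X-minimal) D-stressed =
      D-stressed ,
      λ e e∈D D-e-stressed →
        X-minimal e (D⊆X e∈D) (properStress-elimination D⊆X e∈D X-stressed D-stressed D-e-stressed)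

theorem6p4 : (R : RealField) {n m : ℕ} (T : CSGraph n m) (d : ℕ)
    → let open Framework R T d in
      (p : Config) → Generic p → MinProperlyStressed p ⊤
    → (Cs : List (Subset m)) → IsProperlyStressedCircuitDecomposition p Cs
    → ∀ (j : Fin (length Cs)) → MinProperlyStressed p (Dset Cs (suc (toℕ j)))
theorem6p4 R T d p _ ⊤-minimal Cs (_ , Dⱼ-stressed) j =
  minProperlyStressed-⊆ p ⊆⊤ ⊤-minimal (Dⱼ-stressed j)
  where open FrameworkProperties R T d
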